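{- Let $n\ge 21$ and $2\le s\le 2^{n-1}$. Let $\mathcal{T}=\{\{1,2\},\{1,3\},\{2,3\}\}$ and $\mathcal{S}_3=\{\{1,2\},\{1,3\},\{1,4\}\}$. Let $\mathfrak{I}_\mathcal{T}$ be the set of intersecting families $\mathcal{E}\subset[n]^{(\ge2)}$ of size $s$ with $\mathcal{E}\cap[n]^{(2)}=\mathcal{T}$, and let $\mathfrak{I}_3$ be the set of intersecting families $\mathcal{E}\subset[n]^{(\ge2)}$ of size $s$ with $\mathcal{E}\cap[n]^{(2)}=\mathcal{S}_3$. Then $|\mathfrak{I}_\mathcal{T}|\le|\mathfrak{I}_3|$.
   Context: $[n]^{(r)}$ denotes the $r$-element subsets of $[n]=\{1,\dots,n\}$ and $[n]^{(\ge r)}$ the subsets of size at least $r$. A family is intersecting if any two of its members have nonempty intersection. -}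

module Defs where

open import Data.Bool using (Bool; true; false; _∧_; _∨_; not; if_then_else_)
open import Data.Nat using (ℕ; zero; suc; _≤ᵇ_; _≡ᵇ_)
open import Data.List using (List; []; _∷_; _++_; map; length; filterᵇ)
open import Data.Vec using (Vec; []; _∷_; tabulate)
open import Data.Fin using (Fin; toℕ)
open import Data.Fin.Subset using (Subset; ∣_∣; _∩_)

-- Subsets of [n] are represented by Subset n (characteristic vectors over Fin n).
-- Element k ∈ Fin n stands for the element k+1 of [n] (0-based indexing).

allSubsets : (n : ℕ) → List (Subset n)
allSubsets zero = [] ∷ []
allSubsets (suc n) = map (true ∷_) (allSubsets n) ++ map (false ∷_) (allSubsets n)

-- all sublists (sub-selections) of a list; applied to allSubsets n this
-- enumerates every family of subsets of [n] exactly once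
sublists : {A : Set} → List A → List (List A)
sublists [] = [] ∷ []
sublists (x ∷ xs) = map (x ∷_) (sublists xs) ++ sublists xs

eqSub : {n : ℕ} → Subset n → Subset n → Bool
eqSub [] [] = true
eqSub (true ∷ a) (true ∷ b) = eqSub a b
eqSub (false ∷ a) (false ∷ b) = eqSub a b
eqSub (true ∷ a) (false ∷ b) = false
eqSub (false ∷ a) (true ∷ b) = false

memᵇ : {n : ℕ} → Subset n → List (Subset n) → Bool
memᵇ A [] = false
memᵇ A (B ∷ F) = eqSub A B ∨ memᵇ A F

allᵇ : {A : Set} → (A → Bool) → List A → Bool
allᵇ p [] = true
allᵇ p (x ∷ xs) = p x ∧ allᵇ p xs

iffᵇ : Bool → Bool → Bool
iffᵇ true b = b
iffᵇ false b = not b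

pair : (n : ℕ) → ℕ → ℕ → Subset n
pair n i j = tabulate (λ x → (toℕ x ≡ᵇ i) ∨ (toℕ x ≡ᵇ j))

𝒯 : (n : ℕ) → List (Subset n)
𝒯 n = pair n 0 1 ∷ pair n 0 2 ∷ pair n 1 2 ∷ []

𝒮₃ : (n : ℕ) → List (Subset n)
𝒮₃ n = pair n 0 1 ∷ pair n 0 2 ∷ pair n 0 3 ∷ []

intersectsᵇ : {n : ℕ} → Subset n → Subset n → Bool
intersectsᵇ A B = not (∣ A ∩ B ∣ ≡ᵇ 0)

intersectingᵇ : {n : ℕ} → List (Subset n) → Bool
intersectingᵇ E = allᵇ (λ A → allᵇ (λ B → intersectsᵇ A B) E) E

atLeast2ᵇ : {n : ℕ} → List (Subset n) → Bool
atLeast2ᵇ E = allᵇ (λ A → 2 ≤ᵇ ∣ A ∣) E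

twoShadowIsᵇ : (n : ℕ) → List (Subset n) → List (Subset n) → Bool
twoShadowIsᵇ n E G =
  allᵇ (λ A → if ∣ A ∣ ≡ᵇ 2 then iffᵇ (memᵇ A E) (memᵇ A G) else true) (allSubsets n)

goodᵇ : (n s : ℕ) → List (Subset n) → List (Subset n) → Bool
goodᵇ n s G E = (length E ≡ᵇ s) ∧ atLeast2ᵇ E ∧ intersectingᵇ E ∧ twoShadowIsᵇ n E G

countFamilies : (n s : ℕ) → List (Subset n) → ℕ
countFamilies n s G = length (filterᵇ (goodᵇ n s G) (sublists (allSubsets n)))

module Submission where

-- Let σ be the involution of 2^[n] that exchanges, for
-- every R ⊆ {5,…,n}, the sets {2,3} ∪ R and {1,4} ∪ R, and fixes all other
-- sets.  It preserves sizes and maps 𝒯 = {12,13,23} onto 𝒮₃ = {12,13,14}.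
-- If E ∩ [n]^(2) = 𝒯 and E is intersecting, every member of E meets all of
-- 12, 13, 23; on such sets σ preserves intersection (a finite check on the
-- first four coordinates).  Hence E ↦ σ(E) maps 𝔍_𝒯 injectively into 𝔍_𝒮₃.

open import Defs
open import Algebra.Properties.CommutativeSemigroup using (interchange)
open import Data.Bool using (Bool; true; false; _∧_; _∨_; if_then_else_)
open import Data.Bool.Properties using (⇔→≡; ∧-isCommutativeMonoid; ∨-isCommutativeMonoid; ∨-assoc; ∨-identityʳ; ∨-zeroʳ)
open import Data.Fin.Subset using (Subset; ∣_∣)
open import Data.List using (List; []; _∷_; _++_; map; length; filterᵇ; foldr)
open import Data.List.Properties using (length-++; filter-++; map-++; map-∘; length-map)
open import Data.List.Membership.Propositional using (_∈_)
open import Data.List.Membership.Propositional.Properties using (∈-++⁺ˡ; ∈-++⁺ʳ; ∈-map⁺; ∈-map⁻)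
open import Data.List.Membership.Propositional.Properties.WithK using (unique∧set⇒bag)
open import Data.List.Relation.Binary.BagAndSetEquality using (∼bag⇒↭)
open import Data.List.Relation.Binary.Permutation.Propositional using (_↭_; refl; prep; swap; trans; ↭⇒↭ₛ)
open import Data.List.Relation.Binary.Permutation.Propositional.Properties using (↭-length) renaming (map⁺ to ↭-map⁺; ++⁺ˡ to ↭-++⁺ˡ)
open import Data.List.Relation.Binary.Permutation.Setoid.Properties using (foldr-commMonoid)
open import Data.List.Relation.Unary.Any using (here; there)
import Data.List.Relation.Unary.All as All
import Data.List.Relation.Unary.AllPairs as AllPairs
open import Data.List.Relation.Unary.Unique.Propositional using (Unique)
open import Data.List.Relation.Unary.Unique.Propositional.Properties using () renaming (map⁺ to unique-map⁺; ++⁺ to unique-++⁺)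
open import Data.Nat using (ℕ; zero; suc; _+_; _≤_; _∸_; _^_; s≤s; _≡ᵇ_; _≤ᵇ_)
open import Data.Nat.Properties using (m≤n⇒m≤1+n; +-commutativeSemigroup; ≤-refl; module ≤-Reasoning)
open import Data.Product using (_×_; _,_; proj₁; proj₂)
open import Data.Empty using (⊥)
open import Data.Vec using (Vec; []; _∷_; tabulate) renaming (_++_ to _++ᵥ_)
open import Data.Vec.Properties using (∷-injectiveʳ)
open import Function using (_∘_; mk⇔)
open import Relation.Binary.PropositionalEquality as ≡ using (_≡_; refl; sym; cong; cong₂; subst; module ≡-Reasoning)

∧-split : ∀ {a b : Bool} → a ∧ b ≡ true → a ≡ true × b ≡ true
∧-split {true} {true} refl = refl , refl

∧-intro : ∀ {a b : Bool} → a ≡ true → b ≡ true → a ∧ b ≡ true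
∧-intro refl refl = refl

-- 1. Counting sublists.

count : {A : Set} → (A → Bool) → List A → ℕ
count Q xs = length (filterᵇ Q xs)

count-++ : ∀ {A : Set} (Q : A → Bool) xs ys → count Q (xs ++ ys) ≡ count Q xs + count Q ys
count-++ Q xs ys = ≡.trans (cong length (filter-++ _ xs ys)) (length-++ (filterᵇ Q xs))

count-map : ∀ {A B : Set} (Q : B → Bool) (h : A → B) xs → count Q (map h xs) ≡ count (Q ∘ h) xs
count-map Q h [] = refl
count-map Q h (x ∷ xs) with Q (h x)
... | true = cong suc (count-map Q h xs)
... | false = count-map Q h xs

count-cong : ∀ {A : Set} {Q Q' : A → Bool} → (∀ x → Q x ≡ Q' x) → ∀ xs → count Q xs ≡ count Q' xs
count-cong e [] = refl
count-cong {Q = Q} {Q'} e (x ∷ xs) rewrite e x with Q' x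
... | true = cong suc (count-cong e xs)
... | false = count-cong e xs

count-mono : ∀ {A B : Set} (Q : A → Bool) (Q' : B → Bool) (h : A → B) →
  (∀ x → Q x ≡ true → Q' (h x) ≡ true) → ∀ xs → count Q xs ≤ count Q' (map h xs)
count-mono Q Q' h imp [] = ≤-refl
count-mono Q Q' h imp (x ∷ xs) with Q x in eq
... | true rewrite imp x eq = s≤s (count-mono Q Q' h imp xs)
... | false with Q' (h x)
...   | true = m≤n⇒m≤1+n (count-mono Q Q' h imp xs)
...   | false = count-mono Q Q' h imp xs

sublists-map : ∀ {A B : Set} (f : A → B) xs → sublists (map f xs) ≡ map (map f) (sublists xs)
sublists-map f [] = refl
sublists-map f (x ∷ xs) = begin
  map (f x ∷_) (sublists (map f xs)) ++ sublists (map f xs)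
    ≡⟨ cong (λ S → map (f x ∷_) S ++ S) (sublists-map f xs) ⟩
  map (f x ∷_) (map (map f) (sublists xs)) ++ map (map f) (sublists xs)
    ≡⟨ cong (_++ map (map f) (sublists xs)) (sym (map-∘ (sublists xs))) ⟩
  map (map f ∘ (x ∷_)) (sublists xs) ++ map (map f) (sublists xs)
    ≡⟨ cong (_++ map (map f) (sublists xs)) (map-∘ (sublists xs)) ⟩
  map (map f) (map (x ∷_) (sublists xs)) ++ map (map f) (sublists xs)
    ≡⟨ sym (map-++ (map f) (map (x ∷_) (sublists xs)) (sublists xs)) ⟩
  map (map f) (map (x ∷_) (sublists xs) ++ sublists xs) ∎
  where open ≡-Reasoning

count-sublists-∷ : ∀ {A : Set} (Q : List A → Bool) x xs →
  count Q (sublists (x ∷ xs)) ≡ count (Q ∘ (x ∷_)) (sublists xs) + count Q (sublists xs)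
count-sublists-∷ Q x xs = ≡.trans (count-++ Q (map (x ∷_) (sublists xs)) (sublists xs))
  (cong (_+ count Q (sublists xs)) (count-map Q (x ∷_) (sublists xs)))

PermInvariant : {A : Set} → (List A → Bool) → Set
PermInvariant {A} Q = ∀ {E E' : List A} → E ↭ E' → Q E ≡ Q E'

count-sublists-↭ : ∀ {A : Set} {xs ys : List A} → xs ↭ ys →
  (Q : List A → Bool) → PermInvariant Q → count Q (sublists xs) ≡ count Q (sublists ys)
count-sublists-↭ refl Q inv = refl
count-sublists-↭ {xs = x ∷ xs} {x ∷ ys} (prep x p) Q inv = begin
  count Q (sublists (x ∷ xs))
    ≡⟨ count-sublists-∷ Q x xs ⟩
  count (Q ∘ (x ∷_)) (sublists xs) + count Q (sublists xs)
    ≡⟨ cong₂ _+_ (count-sublists-↭ p (Q ∘ (x ∷_)) (inv ∘ prep x)) (count-sublists-↭ p Q inv) ⟩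
  count (Q ∘ (x ∷_)) (sublists ys) + count Q (sublists ys)
    ≡⟨ sym (count-sublists-∷ Q x ys) ⟩
  count Q (sublists (x ∷ ys)) ∎
  where open ≡-Reasoning
count-sublists-↭ {xs = x ∷ y ∷ xs} {y ∷ x ∷ ys} (swap x y p) Q inv = begin
  count Q (sublists (x ∷ y ∷ xs))
    ≡⟨ expand x y xs ⟩
  (c (x ∷ y ∷ []) xs + c (x ∷ []) xs) + (c (y ∷ []) xs + c [] xs)
    ≡⟨ interchange +-commutativeSemigroup (c (x ∷ y ∷ []) xs) (c (x ∷ []) xs) (c (y ∷ []) xs) (c [] xs) ⟩
  (c (x ∷ y ∷ []) xs + c (y ∷ []) xs) + (c (x ∷ []) xs + c [] xs)
    ≡⟨ cong₂ _+_ (cong₂ _+_ swapped (along (y ∷ []))) (cong₂ _+_ (along (x ∷ [])) (along [])) ⟩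
  (c (y ∷ x ∷ []) ys + c (y ∷ []) ys) + (c (x ∷ []) ys + c [] ys)
    ≡⟨ sym (expand y x ys) ⟩
  count Q (sublists (y ∷ x ∷ ys)) ∎
  where
  open ≡-Reasoning
  c : List _ → List _ → ℕ
  c pre zs = count (Q ∘ (pre ++_)) (sublists zs)
  expand : ∀ u v zs → count Q (sublists (u ∷ v ∷ zs)) ≡
    (c (u ∷ v ∷ []) zs + c (u ∷ []) zs) + (c (v ∷ []) zs + c [] zs)
  expand u v zs = ≡.trans (count-sublists-∷ Q u (v ∷ zs))
    (cong₂ _+_ (count-sublists-∷ (Q ∘ (u ∷_)) v zs) (count-sublists-∷ Q v zs))
  along : ∀ pre → c pre xs ≡ c pre ys
  along pre = count-sublists-↭ p (Q ∘ (pre ++_)) (λ q → inv (↭-++⁺ˡ pre q))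
  swapped : c (x ∷ y ∷ []) xs ≡ c (y ∷ x ∷ []) ys
  swapped = ≡.trans (along (x ∷ y ∷ [])) (count-cong (λ E → inv (swap x y refl)) (sublists ys))
count-sublists-↭ (trans p q) Q inv = ≡.trans (count-sublists-↭ p Q inv) (count-sublists-↭ q Q inv)

count-sublists-≤ : ∀ {A : Set} (L : List A) (f : A → A) → map f L ↭ L →
  (Q Q' : List A → Bool) → PermInvariant Q' →
  (∀ E → Q E ≡ true → Q' (map f E) ≡ true) →
  count Q (sublists L) ≤ count Q' (sublists L)
count-sublists-≤ L f fL↭L Q Q' inv transfer = begin
  count Q (sublists L)                  ≤⟨ count-mono Q Q' (map f) transfer (sublists L) ⟩
  count Q' (map (map f) (sublists L))   ≡⟨ cong (count Q') (sym (sublists-map f L)) ⟩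
  count Q' (sublists (map f L))         ≡⟨ count-sublists-↭ fL↭L Q' inv ⟩
  count Q' (sublists L)                 ∎
  where open ≤-Reasoning

-- 2. Involutions permute the enumeration of all subsets.

∈-allSubsets : ∀ {n} (A : Subset n) → A ∈ allSubsets n
∈-allSubsets [] = here refl
∈-allSubsets {suc n} (true ∷ A) = ∈-++⁺ˡ (∈-map⁺ (true ∷_) (∈-allSubsets A))
∈-allSubsets {suc n} (false ∷ A) = ∈-++⁺ʳ (map (true ∷_) (allSubsets n)) (∈-map⁺ (false ∷_) (∈-allSubsets A))

allSubsets-unique : ∀ n → Unique (allSubsets n)
allSubsets-unique zero = All.[] AllPairs.∷ AllPairs.[]
allSubsets-unique (suc n) =
  unique-++⁺ (unique-map⁺ ∷-injectiveʳ (allSubsets-unique n))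
             (unique-map⁺ ∷-injectiveʳ (allSubsets-unique n)) disjoint
  where
  disjoint : ∀ {A} → A ∈ map (true ∷_) (allSubsets n) × A ∈ map (false ∷_) (allSubsets n) → ⊥
  disjoint (inT , inF) with ∈-map⁻ (true ∷_) inT | ∈-map⁻ (false ∷_) inF
  ... | _ , _ , refl | _ , _ , ()

-- allSubsets n lists every subset exactly once, so applying a bijection
-- (here: an involution) merely permutes it.
involution-↭ : ∀ {n} (f : Subset n → Subset n) → (∀ A → f (f A) ≡ A) →
  map f (allSubsets n) ↭ allSubsets n
involution-↭ {n} f involutive = ∼bag⇒↭ (unique∧set⇒bag
  (unique-map⁺ injective (allSubsets-unique n)) (allSubsets-unique n)
  (mk⇔ (λ _ → ∈-allSubsets _) covered))
  where
  injective : ∀ {A B} → f A ≡ f B → A ≡ B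
  injective {A} {B} eq = ≡.trans (sym (involutive A)) (≡.trans (cong f eq) (involutive B))
  covered : ∀ {A} → A ∈ allSubsets n → A ∈ map f (allSubsets n)
  covered {A} _ = subst (_∈ map f (allSubsets n)) (involutive A) (∈-map⁺ f (∈-allSubsets (f A)))

allᵇ-foldr : ∀ {A : Set} (p : A → Bool) xs → allᵇ p xs ≡ foldr _∧_ true (map p xs)
allᵇ-foldr p [] = refl
allᵇ-foldr p (x ∷ xs) = cong (p x ∧_) (allᵇ-foldr p xs)

memᵇ-foldr : ∀ {n} (A : Subset n) xs → memᵇ A xs ≡ foldr _∨_ false (map (eqSub A) xs)
memᵇ-foldr A [] = refl
memᵇ-foldr A (B ∷ xs) = cong (eqSub A B ∨_) (memᵇ-foldr A xs)

-- Both are folds of a commutative monoid, hence permutation invariant.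
allᵇ-↭ : ∀ {A : Set} (p : A → Bool) {xs ys} → xs ↭ ys → allᵇ p xs ≡ allᵇ p ys
allᵇ-↭ p {xs} {ys} q = begin
  allᵇ p xs                   ≡⟨ allᵇ-foldr p xs ⟩
  foldr _∧_ true (map p xs)   ≡⟨ foldr-commMonoid (≡.setoid Bool) ∧-isCommutativeMonoid (↭⇒↭ₛ (↭-map⁺ p q)) ⟩
  foldr _∧_ true (map p ys)   ≡⟨ sym (allᵇ-foldr p ys) ⟩
  allᵇ p ys                   ∎
  where open ≡-Reasoning

memᵇ-↭ : ∀ {n} (A : Subset n) {xs ys} → xs ↭ ys → memᵇ A xs ≡ memᵇ A ys
memᵇ-↭ A {xs} {ys} q = begin
  memᵇ A xs                              ≡⟨ memᵇ-foldr A xs ⟩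
  foldr _∨_ false (map (eqSub A) xs)     ≡⟨ foldr-commMonoid (≡.setoid Bool) ∨-isCommutativeMonoid (↭⇒↭ₛ (↭-map⁺ (eqSub A) q)) ⟩
  foldr _∨_ false (map (eqSub A) ys)     ≡⟨ sym (memᵇ-foldr A ys) ⟩
  memᵇ A ys                              ∎
  where open ≡-Reasoning

allᵇ-cong : ∀ {A : Set} {p q : A → Bool} → (∀ x → p x ≡ q x) → ∀ xs → allᵇ p xs ≡ allᵇ q xs
allᵇ-cong e [] = refl
allᵇ-cong e (x ∷ xs) = cong₂ _∧_ (e x) (allᵇ-cong e xs)

good-invariant : ∀ n s G → PermInvariant (goodᵇ n s G)
good-invariant n s G {E} q =
  cong₂ _∧_ (cong (_≡ᵇ s) (↭-length q))
  (cong₂ _∧_ (allᵇ-↭ _ q)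
  (cong₂ _∧_ (≡.trans (allᵇ-cong (λ A → allᵇ-↭ _ q) E) (allᵇ-↭ _ q))
             (allᵇ-cong (λ A → cong (λ b → if ∣ A ∣ ≡ᵇ 2 then iffᵇ b (memᵇ A G) else true)
                                     (memᵇ-↭ A q))
                        (allSubsets n))))

allᵇ-∈ : ∀ {A : Set} {p : A → Bool} {x} xs → allᵇ p xs ≡ true → x ∈ xs → p x ≡ true
allᵇ-∈ (y ∷ xs) h (here refl) = proj₁ (∧-split h)
allᵇ-∈ (y ∷ xs) h (there x∈xs) = allᵇ-∈ xs (proj₂ (∧-split h)) x∈xs

allᵇ-intro : ∀ {A : Set} {p : A → Bool} xs → (∀ {x} → x ∈ xs → p x ≡ true) → allᵇ p xs ≡ true
allᵇ-intro [] all = refl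
allᵇ-intro (x ∷ xs) all = ∧-intro (all (here refl)) (allᵇ-intro xs (all ∘ there))

allᵇ-map : ∀ {A B : Set} (p : B → Bool) (f : A → B) xs → allᵇ p (map f xs) ≡ allᵇ (p ∘ f) xs
allᵇ-map p f [] = refl
allᵇ-map p f (x ∷ xs) = cong (p (f x) ∧_) (allᵇ-map p f xs)

eqSub-refl : ∀ {n} (A : Subset n) → eqSub A A ≡ true
eqSub-refl [] = refl
eqSub-refl (true ∷ A) = eqSub-refl A
eqSub-refl (false ∷ A) = eqSub-refl A

eqSub-sound : ∀ {n} (A B : Subset n) → eqSub A B ≡ true → A ≡ B
eqSub-sound [] [] h = refl
eqSub-sound (true ∷ A) (true ∷ B) h = cong (true ∷_) (eqSub-sound A B h)
eqSub-sound (false ∷ A) (false ∷ B) h = cong (false ∷_) (eqSub-sound A B h)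

memᵇ-complete : ∀ {n} {X : Subset n} E → X ∈ E → memᵇ X E ≡ true
memᵇ-complete {X = X} (Y ∷ E) (here refl) rewrite eqSub-refl X = refl
memᵇ-complete {X = X} (Y ∷ E) (there X∈E) rewrite memᵇ-complete E X∈E = ∨-zeroʳ (eqSub X Y)

memᵇ-sound : ∀ {n} (X : Subset n) E → memᵇ X E ≡ true → X ∈ E
memᵇ-sound X (Y ∷ E) h with eqSub X Y in eq
... | true = here (eqSub-sound X Y eq)
... | false = there (memᵇ-sound X E h)

shadow-⊆ : ∀ n {E G : List (Subset n)} → twoShadowIsᵇ n E G ≡ true →
  ∀ {X} → X ∈ G → ∣ X ∣ ≡ 2 → X ∈ E
shadow-⊆ n {E} {G} shadow {X} X∈G size = memᵇ-sound X E (inE (memᵇ X E) entry)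
  where
  entry : (if ∣ X ∣ ≡ᵇ 2 then iffᵇ (memᵇ X E) (memᵇ X G) else true) ≡ true
  entry = allᵇ-∈ (allSubsets n) shadow (∈-allSubsets X)
  inE : ∀ b → (if ∣ X ∣ ≡ᵇ 2 then iffᵇ b (memᵇ X G) else true) ≡ true → b ≡ true
  inE b h rewrite size | memᵇ-complete G X∈G with b
  ... | true = refl

intersecting-meets : ∀ {n} {E : List (Subset n)} → intersectingᵇ E ≡ true →
  ∀ {A B} → A ∈ E → B ∈ E → intersectsᵇ A B ≡ true
intersecting-meets {E = E} h A∈E B∈E = allᵇ-∈ E (allᵇ-∈ E h A∈E) B∈E

-- 4. The involution σ.

intersects-∷ : ∀ {m} a b (A B : Subset m) → intersectsᵇ (a ∷ A) (b ∷ B) ≡ (a ∧ b) ∨ intersectsᵇ A B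
intersects-∷ true true A B = refl
intersects-∷ true false A B = refl
intersects-∷ false b A B = refl

intersects-++ : ∀ {k m} (p q : Vec Bool k) (A B : Subset m) →
  intersectsᵇ (p ++ᵥ A) (q ++ᵥ B) ≡ intersectsᵇ p q ∨ intersectsᵇ A B
intersects-++ [] [] A B = refl
intersects-++ (a ∷ p) (b ∷ q) A B = begin
  intersectsᵇ (a ∷ p ++ᵥ A) (b ∷ q ++ᵥ B)            ≡⟨ intersects-∷ a b (p ++ᵥ A) (q ++ᵥ B) ⟩
  (a ∧ b) ∨ intersectsᵇ (p ++ᵥ A) (q ++ᵥ B)          ≡⟨ cong ((a ∧ b) ∨_) (intersects-++ p q A B) ⟩
  (a ∧ b) ∨ (intersectsᵇ p q ∨ intersectsᵇ A B)      ≡⟨ sym (∨-assoc (a ∧ b) _ _) ⟩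
  ((a ∧ b) ∨ intersectsᵇ p q) ∨ intersectsᵇ A B      ≡⟨ cong (_∨ intersectsᵇ A B) (sym (intersects-∷ a b p q)) ⟩
  intersectsᵇ (a ∷ p) (b ∷ q) ∨ intersectsᵇ A B      ∎
  where open ≡-Reasoning

-- The empty set (as it appears in the tail of a pair) meets nothing.
intersects-empty : ∀ {m} (A : Subset m) → intersectsᵇ A (tabulate (λ _ → false)) ≡ false
intersects-empty [] = refl
intersects-empty (true ∷ A) = intersects-empty A
intersects-empty (false ∷ A) = intersects-empty A

-- A meets each of the three pairs of 𝒯, i.e. contains two of the points 1, 2, 3.
transversalᵇ : ∀ {n} → Subset n → Bool
transversalᵇ {n} A = allᵇ (intersectsᵇ A) (𝒯 n)

transversal-prefix : ∀ {m} (p : Vec Bool 4) (r : Subset m) → transversalᵇ (p ++ᵥ r) ≡ transversalᵇ p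
transversal-prefix p r =
  cong₂ _∧_ (meets (pair 4 0 1)) (cong₂ _∧_ (meets (pair 4 0 2)) (cong₂ _∧_ (meets (pair 4 1 2)) refl))
  where
  meets : ∀ X → intersectsᵇ (p ++ᵥ r) (X ++ᵥ tabulate (λ _ → false)) ≡ intersectsᵇ p X
  meets X = ≡.trans (intersects-++ p X r _)
    (≡.trans (cong (intersectsᵇ p X ∨_) (intersects-empty r)) (∨-identityʳ _))

swap₄ : Vec Bool 4 → Vec Bool 4
swap₄ (false ∷ true ∷ true ∷ false ∷ []) = true ∷ false ∷ false ∷ true ∷ []
swap₄ (true ∷ false ∷ false ∷ true ∷ []) = false ∷ true ∷ true ∷ false ∷ []
swap₄ p = p

swap₄-involutive : ∀ p → swap₄ (swap₄ p) ≡ p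
swap₄-involutive (true ∷ true ∷ c ∷ d ∷ []) = refl
swap₄-involutive (true ∷ false ∷ true ∷ d ∷ []) = refl
swap₄-involutive (true ∷ false ∷ false ∷ true ∷ []) = refl
swap₄-involutive (true ∷ false ∷ false ∷ false ∷ []) = refl
swap₄-involutive (false ∷ false ∷ c ∷ d ∷ []) = refl
swap₄-involutive (false ∷ true ∷ false ∷ d ∷ []) = refl
swap₄-involutive (false ∷ true ∷ true ∷ true ∷ []) = refl
swap₄-involutive (false ∷ true ∷ true ∷ false ∷ []) = refl

swap₄-size : ∀ p → ∣ swap₄ p ∣ ≡ ∣ p ∣
swap₄-size (true ∷ true ∷ c ∷ d ∷ []) = refl
swap₄-size (true ∷ false ∷ true ∷ d ∷ []) = refl
swap₄-size (true ∷ false ∷ false ∷ true ∷ []) = refl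
swap₄-size (true ∷ false ∷ false ∷ false ∷ []) = refl
swap₄-size (false ∷ false ∷ c ∷ d ∷ []) = refl
swap₄-size (false ∷ true ∷ false ∷ d ∷ []) = refl
swap₄-size (false ∷ true ∷ true ∷ true ∷ []) = refl
swap₄-size (false ∷ true ∷ true ∷ false ∷ []) = refl

swap₄-keeps-meeting : Vec Bool 4 → Vec Bool 4 → Bool
swap₄-keeps-meeting p q =
  if transversalᵇ p ∧ transversalᵇ q ∧ intersectsᵇ p q
  then intersectsᵇ (swap₄ p) (swap₄ q) else true

-- The only transversal pattern moved by swap₄ is {2,3}, sent to {1,4}; every
-- other transversal pattern contains 1, or is {2,3,4} and meets {1,4} in 4.
-- Verified by evaluating all 16 × 16 cases.
swap₄-table : allᵇ (λ p → allᵇ (swap₄-keeps-meeting p) (allSubsets 4)) (allSubsets 4) ≡ true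
swap₄-table = refl

swap₄-meets : ∀ p q → transversalᵇ p ≡ true → transversalᵇ q ≡ true →
  intersectsᵇ p q ≡ true → intersectsᵇ (swap₄ p) (swap₄ q) ≡ true
swap₄-meets p q tp tq pq = implied tp tq pq entry
  where
  row : allᵇ (swap₄-keeps-meeting p) (allSubsets 4) ≡ true
  row = allᵇ-∈ {p = λ p → allᵇ (swap₄-keeps-meeting p) (allSubsets 4)} (allSubsets 4) swap₄-table (∈-allSubsets p)
  entry : swap₄-keeps-meeting p q ≡ true
  entry = allᵇ-∈ {p = swap₄-keeps-meeting p} (allSubsets 4) row (∈-allSubsets q)
  implied : ∀ {a b c x : Bool} → a ≡ true → b ≡ true → c ≡ true →
    (if a ∧ b ∧ c then x else true) ≡ true → x ≡ true
  implied refl refl refl h = h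

σ : ∀ {m} → Subset (4 + m) → Subset (4 + m)
σ (a ∷ b ∷ c ∷ d ∷ r) = swap₄ (a ∷ b ∷ c ∷ d ∷ []) ++ᵥ r

σ-++ : ∀ {m} (p : Vec Bool 4) (r : Subset m) → σ (p ++ᵥ r) ≡ swap₄ p ++ᵥ r
σ-++ (a ∷ b ∷ c ∷ d ∷ []) r = refl

σ-involutive : ∀ {m} (A : Subset (4 + m)) → σ (σ A) ≡ A
σ-involutive (a ∷ b ∷ c ∷ d ∷ r) =
  ≡.trans (σ-++ (swap₄ p) r) (cong (_++ᵥ r) (swap₄-involutive p))
  where p = a ∷ b ∷ c ∷ d ∷ []

∣-++ : ∀ {k m} (p : Vec Bool k) (r : Subset m) → ∣ p ++ᵥ r ∣ ≡ ∣ p ∣ + ∣ r ∣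
∣-++ [] r = refl
∣-++ (true ∷ p) r = cong suc (∣-++ p r)
∣-++ (false ∷ p) r = ∣-++ p r

σ-size : ∀ {m} (A : Subset (4 + m)) → ∣ σ A ∣ ≡ ∣ A ∣
σ-size (a ∷ b ∷ c ∷ d ∷ r) =
  ≡.trans (∣-++ (swap₄ p) r) (≡.trans (cong (_+ ∣ r ∣) (swap₄-size p)) (sym (∣-++ p r)))
  where p = a ∷ b ∷ c ∷ d ∷ []

σ-𝒯 : ∀ {m} → map σ (𝒯 (4 + m)) ≡ 𝒮₃ (4 + m)
σ-𝒯 = refl

σ-meets : ∀ {m} (A B : Subset (4 + m)) → transversalᵇ A ≡ true → transversalᵇ B ≡ true →
  intersectsᵇ A B ≡ true → intersectsᵇ (σ A) (σ B) ≡ true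
σ-meets (a ∷ b ∷ c ∷ d ∷ r) (a' ∷ b' ∷ c' ∷ d' ∷ r') tA tB AB =
  ≡.trans (intersects-++ (swap₄ p) (swap₄ q) r r')
          (split (≡.trans (sym (intersects-++ p q r r')) AB))
  where
  p = a ∷ b ∷ c ∷ d ∷ []
  q = a' ∷ b' ∷ c' ∷ d' ∷ []
  split : intersectsᵇ p q ∨ intersectsᵇ r r' ≡ true →
    intersectsᵇ (swap₄ p) (swap₄ q) ∨ intersectsᵇ r r' ≡ true
  split h with intersectsᵇ p q in pq
  ... | true rewrite swap₄-meets p q (≡.trans (sym (transversal-prefix p r)) tA)
                                     (≡.trans (sym (transversal-prefix q r')) tB) pq = refl
  ... | false rewrite h = ∨-zeroʳ _

eqSub-complete : ∀ {n} {A B : Subset n} → A ≡ B → eqSub A B ≡ true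
eqSub-complete {A = A} refl = eqSub-refl A

module _ {n : ℕ} (f : Subset n → Subset n) (involutive : ∀ A → f (f A) ≡ A) where

  eqSub-involution : ∀ A B → eqSub A (f B) ≡ eqSub (f A) B
  eqSub-involution A B = ⇔→≡ (mk⇔
    (λ h → eqSub-complete (≡.trans (cong f (eqSub-sound A (f B) h)) (involutive B)))
    (λ h → eqSub-complete (≡.trans (sym (involutive A)) (cong f (eqSub-sound (f A) B h)))))

  memᵇ-involution : ∀ A E → memᵇ A (map f E) ≡ memᵇ (f A) E
  memᵇ-involution A [] = refl
  memᵇ-involution A (B ∷ E) = cong₂ _∨_ (eqSub-involution A B) (memᵇ-involution A E)

  shadow-involution : (∀ A → ∣ f A ∣ ≡ ∣ A ∣) → ∀ E G →
    twoShadowIsᵇ n (map f E) (map f G) ≡ twoShadowIsᵇ n E G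
  shadow-involution size E G = begin
    allᵇ (φ (map f E) (map f G)) (allSubsets n)   ≡⟨ allᵇ-cong pointwise (allSubsets n) ⟩
    allᵇ (φ E G ∘ f) (allSubsets n)               ≡⟨ sym (allᵇ-map (φ E G) f (allSubsets n)) ⟩
    allᵇ (φ E G) (map f (allSubsets n))           ≡⟨ allᵇ-↭ (φ E G) (involution-↭ f involutive) ⟩
    allᵇ (φ E G) (allSubsets n)                   ∎
    where
    open ≡-Reasoning
    φ : List (Subset n) → List (Subset n) → Subset n → Bool
    φ E G A = if ∣ A ∣ ≡ᵇ 2 then iffᵇ (memᵇ A E) (memᵇ A G) else true
    pointwise : ∀ A → φ (map f E) (map f G) A ≡ φ E G (f A)
    pointwise A rewrite size A | memᵇ-involution A E | memᵇ-involution A G = refl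

empty-size : ∀ m → ∣ tabulate {n = m} (λ _ → false) ∣ ≡ 0
empty-size zero = refl
empty-size (suc m) = empty-size m

𝒯-size : ∀ {m X} → X ∈ 𝒯 (4 + m) → ∣ X ∣ ≡ 2
𝒯-size {m} (here refl) = cong (2 +_) (empty-size m)
𝒯-size {m} (there (here refl)) = cong (2 +_) (empty-size m)
𝒯-size {m} (there (there (here refl))) = cong (2 +_) (empty-size m)

σ-intersecting : ∀ {m} (E : List (Subset (4 + m))) → (∀ {X} → X ∈ 𝒯 (4 + m) → X ∈ E) →
  intersectingᵇ E ≡ true → intersectingᵇ (map σ E) ≡ true
σ-intersecting {m} E 𝒯⊆E intersecting =
  ≡.trans (allᵇ-map _ σ E) (allᵇ-intro E λ {A} A∈E →
  ≡.trans (allᵇ-map _ σ E) (allᵇ-intro E λ {B} B∈E →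
    σ-meets A B (transversal A∈E) (transversal B∈E) (intersecting-meets intersecting A∈E B∈E)))
  where
  transversal : ∀ {A} → A ∈ E → transversalᵇ A ≡ true
  transversal A∈E = allᵇ-intro (𝒯 (4 + m)) (λ X∈𝒯 → intersecting-meets intersecting A∈E (𝒯⊆E X∈𝒯))

σ-transfer : ∀ m s (E : List (Subset (4 + m))) → goodᵇ (4 + m) s (𝒯 (4 + m)) E ≡ true →
  goodᵇ (4 + m) s (𝒮₃ (4 + m)) (map σ E) ≡ true
σ-transfer m s E good with ∧-split good
... | sized , rest with ∧-split rest
... | large , rest′ with ∧-split rest′
... | intersecting , shadow =
  ∧-intro (≡.trans (cong (_≡ᵇ s) (length-map σ E)) sized)
  (∧-intro (≡.trans (allᵇ-map _ σ E) (≡.trans (allᵇ-cong (λ A → cong (2 ≤ᵇ_) (σ-size A)) E) large))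
  (∧-intro (σ-intersecting E (λ X∈𝒯 → shadow-⊆ (4 + m) shadow X∈𝒯 (𝒯-size X∈𝒯)) intersecting)
           (subst (λ G → twoShadowIsᵇ (4 + m) (map σ E) G ≡ true) σ-𝒯
                  (≡.trans (shadow-involution σ σ-involutive σ-size E (𝒯 (4 + m))) shadow))))

𝒯≤𝒮₃ : ∀ m s → countFamilies (4 + m) s (𝒯 (4 + m)) ≤ countFamilies (4 + m) s (𝒮₃ (4 + m))
𝒯≤𝒮₃ m s = count-sublists-≤ (allSubsets (4 + m)) σ (involution-↭ σ σ-involutive)
  (goodᵇ (4 + m) s (𝒯 (4 + m))) (goodᵇ (4 + m) s (𝒮₃ (4 + m)))
  (good-invariant (4 + m) s (𝒮₃ (4 + m))) (σ-transfer m s)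

lemma7 : (n s : ℕ) → 21 ≤ n → 2 ≤ s → s ≤ 2 ^ (n ∸ 1) →
    countFamilies n s (𝒯 n) ≤ countFamilies n s (𝒮₃ n)
lemma7 (suc (suc (suc (suc m)))) s _ _ _ = 𝒯≤𝒮₃ m s
lemma7 (suc (suc (suc zero))) s (s≤s (s≤s (s≤s ()))) _ _
lemma7 (suc (suc zero)) s (s≤s (s≤s ())) _ _
lemma7 (suc zero) s (s≤s ()) _ _
lemma7 zero s () _ _
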